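{- Let $H=(V,E)$ be an unweighted hypergraph on $n$ vertices and let $\lambda\in\mathbb{R}$. Let $E_{<\lambda}=\{e\in E: \lambda_e<\lambda\}$ be the set of hyperedges of strength less than $\lambda$ in $H$. Then in the hypergraph $H - E_{<\lambda}$ (same vertex set, hyperedge set $E\setminus E_{<\lambda}$), every hyperedge has strength at least $\lambda$.
   Context: A hypergraph $H=(V,E)$ has a finite vertex set $V$ and a (multi)set $E$ of hyperedges, each a subset of $V$ with at least two vertices. For a partition of $V$ into nonempty parts $V_1,\dots,V_k$, $E[V_1,\dots,V_k]$ is the set of hyperedges not contained in any single part. $\Phi(H)=\min_{2\le k\le |V|}\min_{V_1\cup\dots\cup V_k=V}|E[V_1,\dots,V_k]|/(k-1)$ over partitions into $k$ nonempty parts. For $S\subseteq V$, $H[S]$ is the sub-hypergraph on $S$ of hyperedges contained in $S$. Strength $\lambda_e$ (relative to the hypergraph under consideration) is defined recursively: choose a partition $V_1,\dots,V_k$ attaining $\Phi$ of that hypergraph; each crossing hyperedge gets strength equal to that value; every other hyperedge lies in some $V_i$ and gets its strength recursively computed inside the induced sub-hypergraph on $V_i$.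
   Formalization: The threshold λ ranges over the rationals instead of the reals. -}

module Defs where

open import Data.Bool using (Bool; true; false; _∧_; _∨_; not)
open import Data.Nat using (ℕ; zero; suc; _+_)
open import Data.Integer using (+_)
open import Data.Rational using (ℚ; _/_; _≤_; _<_; _<?_)
open import Data.Fin using (Fin; _≟_)
open import Data.Fin.Subset using (Subset; _∈_; _⊆_)
open import Data.Fin.Subset.Properties using (_⊆?_)
open import Data.Vec using (lookup; tabulate)
open import Data.Product using (Σ; _×_)
open import Data.Empty using (⊥)
open import Relation.Nullary.Decidable using (⌊_⌋)
open import Relation.Binary.PropositionalEquality using (_≡_)

-- A hypergraph on vertex set Fin n with m hyperedges (a multiset, hence
-- indexed by Fin m) is given by  E : Fin m → Subset n.
-- We work with "sub-hypergraphs" (S , A): an active vertex set S : Subset n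
-- and an active hyperedge set A : Subset m (all contained in S).

anyFin : ∀ {n} → (Fin n → Bool) → Bool
anyFin {zero}  f = false
anyFin {suc n} f = f Fin.zero ∨ anyFin (λ i → f (Fin.suc i))

b2n : Bool → ℕ
b2n true  = 1
b2n false = 0

countFin : ∀ {m} → (Fin m → Bool) → ℕ
countFin {zero}  f = 0
countFin {suc m} f = b2n (f Fin.zero) + countFin (λ i → f (Fin.suc i))

crosses : ∀ {n k} → (Fin n → Fin k) → Subset n → Bool
crosses p s = anyFin λ u → anyFin λ v →
  lookup s u ∧ (lookup s v ∧ not ⌊ p u ≟ p v ⌋)

-- A partition of S into k = 2 + j nonempty parts, given by a labelling
-- p : Fin n → Fin (2 + j) (its values outside S are irrelevant);
-- every label is used by some vertex of S.
IsPartition : ∀ {n} (S : Subset n) (j : ℕ) → (Fin n → Fin (2 + j)) → Set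
IsPartition {n} S j p = (i : Fin (2 + j)) → Σ (Fin n) λ u → u ∈ S × p u ≡ i

crossCount : ∀ {n m} (E : Fin m → Subset n) (A : Subset m) {k : ℕ} →
  (Fin n → Fin k) → ℕ
crossCount E A p = countFin λ e → lookup A e ∧ crosses p (E e)

-- |E[V_1,...,V_k]| / (k - 1)  with k = 2 + j
ratio : ∀ {n m} (E : Fin m → Subset n) (A : Subset m) (j : ℕ) →
  (Fin n → Fin (2 + j)) → ℚ
ratio E A j p = (+ crossCount E A p) / suc j

Optimal : ∀ {n m} (E : Fin m → Subset n) (S : Subset n) (A : Subset m)
  (j : ℕ) → (Fin n → Fin (2 + j)) → Set
Optimal {n} E S A j p =
  (j' : ℕ) (p' : Fin n → Fin (2 + j')) → IsPartition S j' p' →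
  ratio E A j p ≤ ratio E A j' p'

part : ∀ {n k} (S : Subset n) → (Fin n → Fin k) → Fin k → Subset n
part S p i = tabulate λ u → lookup S u ∧ ⌊ p u ≟ i ⌋

inside : ∀ {n m} (E : Fin m → Subset n) (A : Subset m) (T : Subset n) →
  Subset m
inside E A T = tabulate λ e → lookup A e ∧ ⌊ E e ⊆? T ⌋

-- IsStrength E S A σ : σ is a strength assignment for the hypergraph
-- (S , A) obtained by the recursive definition (for SOME choice of optimal
-- partitions at each step). Only the values of σ on A are constrained.
data IsStrength {n m : ℕ} (E : Fin m → Subset n) :
       Subset n → Subset m → (Fin m → ℚ) → Set where
  leaf : ∀ {S A σ} → (∀ e → e ∈ A → ⊥) → IsStrength E S A σ
  node : ∀ {S A σ} (j : ℕ) (p : Fin n → Fin (2 + j)) →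
    IsPartition S j p →
    Optimal E S A j p →
    (∀ e → e ∈ A → crosses p (E e) ≡ true → σ e ≡ ratio E A j p) →
    (∀ i → IsStrength E (part S p i) (inside E A (part S p i)) σ) →
    IsStrength E S A σ

atLeast : ∀ {m} → ℚ → (Fin m → ℚ) → Subset m
atLeast λ' σ = tabulate λ e → not ⌊ σ e <? λ' ⌋

-- Everything is an exchange argument against an optimal partition p of a vertex set S chosen by the
-- recursion. Refining one part V of p by a partition of V gives a partition of S, so optimality of p
-- yields Φ(H[V]) ≥ Φ(H[S]). Merging into one part all parts of p met by a set T ⊆ S gives a coarser
-- partition of S, so if T meets two parts then Φ(H[T]) ≤ Φ(H[S]). Following a hyperedge e down the
-- recursion, these show λ_e ≥ Φ(H[T]) for every vertex set T ⊇ e. In H, the set S at which e is cut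
-- has Φ(H[S]) = λ_e, and by the previous fact every hyperedge of H[S] has strength ≥ λ_e; so if
-- λ_e ≥ λ, removing E_{<λ} leaves H[S] with Φ ≥ λ. The same fact in H − E_{<λ}, applied to
-- S ⊇ e, gives the theorem.

module Submission where

open import Defs
open import Data.Nat using (ℕ; _≤_)
open import Data.Rational using (ℚ) renaming (_≤_ to _≤ℚ_)
open import Data.Fin using (Fin)
open import Data.Fin.Subset using (Subset; ⊤; ∣_∣; _∈_)

open import Data.Bool using (Bool; true; false; _∧_; not; if_then_else_)
open import Data.Bool.Properties using (∧-conicalˡ; ∧-conicalʳ; ¬-not) renaming (_≟_ to _≟ᵇ_)
open import Data.Nat using (zero; suc; _+_; _*_; z≤n; s≤s; s≤s⁻¹)
import Data.Nat.Properties as ℕ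
open import Data.Nat.Tactic.RingSolver using (solve-∀)
open import Algebra.Properties.CommutativeSemigroup ℕ.+-commutativeSemigroup
  using (interchange; x∙yz≈y∙xz)
open import Data.Fin using (zero; suc; _≟_; _↑ˡ_; _↑ʳ_; punchIn; punchOut)
open import Data.Fin.Properties
  using (punchInᵢ≢i; punchOut-cong; punchOut-punchIn; punchIn-punchOut; any?; all?; ¬∀⟶∃¬)
open import Data.Fin.Subset using (_⊆_)
open import Data.Fin.Subset.Properties using (_∈?_; _⊆?_; nonempty?; ∈⊤; ⊆-refl)
open import Data.Integer using (+_; +≤+) renaming (_≤_ to _≤ℤ_)
import Data.Integer.Properties as ℤ
open import Data.Rational using (_/_; toℚᵘ; _<?_)
import Data.Rational.Properties as ℚ
open import Data.Rational.Unnormalised using (mkℚᵘ; *≤*) renaming (_≃_ to _≃ᵘ_)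
import Data.Rational.Unnormalised.Properties as ℚᵘ
open import Data.Vec using (lookup; tabulate)
open import Data.Vec.Properties using (lookup∘tabulate; []=⇒lookup; lookup⇒[]=)
open import Data.Product using (∃; ∃₂; _×_; _,_; proj₁; proj₂)
open import Data.Sum using (_⊎_; inj₁; inj₂)
import Data.Sum as Sum
open import Data.Empty using (⊥; ⊥-elim)
open import Function using (_∘_; case_of_)
open import Relation.Nullary using (¬_; Dec; yes; no; contradiction)
open import Relation.Nullary.Decidable using (⌊_⌋; _×-dec_; ¬?; decidable-stable)
open import Relation.Binary.PropositionalEquality

isYes⁺ : ∀ {a} {A : Set a} (a? : Dec A) → A → ⌊ a? ⌋ ≡ true
isYes⁺ (yes _) _ = refl
isYes⁺ (no ¬a) a = contradiction a ¬a

isYes⁻ : ∀ {a} {A : Set a} (a? : Dec A) → ⌊ a? ⌋ ≡ true → A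
isYes⁻ (yes a) _ = a

isYes-false : ∀ {a} {A : Set a} (a? : Dec A) → ¬ A → ⌊ a? ⌋ ≡ false
isYes-false (yes a) ¬a = contradiction a ¬a
isYes-false (no _) _ = refl

∈-tabulate⁺ : ∀ {n} {f : Fin n → Bool} {x} → f x ≡ true → x ∈ tabulate f
∈-tabulate⁺ {f = f} {x} fx = lookup⇒[]= x (tabulate f) (trans (lookup∘tabulate f x) fx)

∈-tabulate⁻ : ∀ {n} {f : Fin n → Bool} {x} → x ∈ tabulate f → f x ≡ true
∈-tabulate⁻ {f = f} {x} x∈ = trans (sym (lookup∘tabulate f x)) ([]=⇒lookup x∈)

-- Counting

anyFin⁺ : ∀ {n} (f : Fin n → Bool) i → f i ≡ true → anyFin f ≡ true
anyFin⁺ f zero fi rewrite fi = refl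
anyFin⁺ f (suc i) fi with f zero
... | true = refl
... | false = anyFin⁺ (f ∘ suc) i fi

anyFin⁻ : ∀ {n} (f : Fin n → Bool) → anyFin f ≡ true → ∃ λ i → f i ≡ true
anyFin⁻ {suc n} f any with f zero in f0
... | true = zero , f0
... | false = let i , fi = anyFin⁻ (f ∘ suc) any in suc i , fi

b2n≤1 : ∀ b → b2n b ≤ 1
b2n≤1 true = s≤s z≤n
b2n≤1 false = z≤n

b2n-mono : ∀ {a b} → (a ≡ true → b ≡ true) → b2n a ≤ b2n b
b2n-mono {false} _ = z≤n
b2n-mono {true} a⇒b rewrite a⇒b refl = ℕ.≤-refl

b2n-∨ : ∀ {a b c} → (c ≡ true → a ≡ true ⊎ b ≡ true) → b2n c ≤ b2n a + b2n b
b2n-∨ {c = false} _ = z≤n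
b2n-∨ {a} {c = true} c⇒a∨b with c⇒a∨b refl
... | inj₁ refl = s≤s z≤n
... | inj₂ refl = ℕ.m≤n+m 1 (b2n a)

b2n-disjoint : ∀ {a b c} → (a ≡ true → c ≡ true) → (b ≡ true → c ≡ true) →
  (a ≡ true → b ≡ true → ⊥) → b2n a + b2n b ≤ b2n c
b2n-disjoint {false} {false} _ _ _ = z≤n
b2n-disjoint {true} {false} a⇒c _ _ rewrite a⇒c refl = ℕ.≤-refl
b2n-disjoint {false} {true} _ b⇒c _ rewrite b⇒c refl = ℕ.≤-refl
b2n-disjoint {true} {true} _ _ ¬both = ⊥-elim (¬both refl refl)

count≤n : ∀ {n} (f : Fin n → Bool) → countFin f ≤ n
count≤n {zero} f = z≤n
count≤n {suc n} f = ℕ.+-mono-≤ (b2n≤1 (f zero)) (count≤n (f ∘ suc))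

count-all : ∀ {n} {f : Fin n → Bool} → (∀ i → f i ≡ true) → countFin f ≡ n
count-all {zero} _ = refl
count-all {suc n} all rewrite all zero = cong suc (count-all (all ∘ suc))

count-mono : ∀ {n} {f g : Fin n → Bool} → (∀ i → f i ≡ true → g i ≡ true) →
  countFin f ≤ countFin g
count-mono {zero} _ = z≤n
count-mono {suc n} f⇒g = ℕ.+-mono-≤ (b2n-mono (f⇒g zero)) (count-mono (f⇒g ∘ suc))

count-∨ : ∀ {n} {f g h : Fin n → Bool} → (∀ i → h i ≡ true → f i ≡ true ⊎ g i ≡ true) →
  countFin h ≤ countFin f + countFin g
count-∨ {zero} _ = z≤n
count-∨ {suc n} {f} {g} h⇒f∨g = ℕ.≤-trans
  (ℕ.+-mono-≤ (b2n-∨ (h⇒f∨g zero)) (count-∨ (h⇒f∨g ∘ suc)))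
  (ℕ.≤-reflexive (interchange (b2n (f zero)) (b2n (g zero)) _ _))

count-disjoint : ∀ {n} {f g h : Fin n → Bool} →
  (∀ i → f i ≡ true → h i ≡ true) → (∀ i → g i ≡ true → h i ≡ true) →
  (∀ i → f i ≡ true → g i ≡ true → ⊥) → countFin f + countFin g ≤ countFin h
count-disjoint {zero} _ _ _ = z≤n
count-disjoint {suc n} {f} {g} f⇒h g⇒h disjoint = ℕ.≤-trans
  (ℕ.≤-reflexive (interchange (b2n (f zero)) _ (b2n (g zero)) _))
  (ℕ.+-mono-≤ (b2n-disjoint (f⇒h zero) (g⇒h zero) (disjoint zero))
              (count-disjoint (f⇒h ∘ suc) (g⇒h ∘ suc) (disjoint ∘ suc)))

count-punchIn : ∀ {n} (f : Fin (suc n) → Bool) i →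
  countFin f ≡ b2n (f i) + countFin (f ∘ punchIn i)
count-punchIn f zero = refl
count-punchIn {suc n} f (suc i) = trans
  (cong (λ c → b2n (f zero) + c) (count-punchIn (f ∘ suc) i))
  (x∙yz≈y∙xz (b2n (f zero)) (b2n (f (suc i))) _)

count-punchIn-true : ∀ {n} {f : Fin (suc n) → Bool} {i} → f i ≡ true →
  countFin f ≡ suc (countFin (f ∘ punchIn i))
count-punchIn-true {f = f} {i} fi =
  trans (count-punchIn f i) (cong (λ b → b2n b + countFin (f ∘ punchIn i)) fi)

count≥1 : ∀ {n} {f : Fin n → Bool} {i} → f i ≡ true → 1 ≤ countFin f
count≥1 {suc n} {f} {i} fi = subst (1 ≤_) (sym (count-punchIn-true {f = f} {i} fi)) (s≤s z≤n)

count≥2 : ∀ {n} {f : Fin n → Bool} {i j} → f i ≡ true → f j ≡ true → i ≢ j → 2 ≤ countFin f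
count≥2 {suc n} {f} {i} fi fj i≢j = ℕ.≤-trans
  (s≤s (count≥1 {f = f ∘ punchIn i} (trans (cong f (punchIn-punchOut i≢j)) fj)))
  (ℕ.≤-reflexive (sym (count-punchIn-true {f = f} {i} fi)))

count-punchIn-all : ∀ {n} {f : Fin (suc n) → Bool} i → (∀ m → f (punchIn i m) ≡ true) →
  n ≤ countFin f
count-punchIn-all {n} {f} i all = begin
  n                                      ≡⟨ count-all all ⟨
  countFin (f ∘ punchIn i)               ≤⟨ ℕ.m≤n+m _ (b2n (f i)) ⟩
  b2n (f i) + countFin (f ∘ punchIn i)   ≡⟨ count-punchIn f i ⟨
  countFin f                             ∎
  where open ℕ.≤-Reasoning

count-↑ : ∀ {K L} (f : Fin (K + L) → Bool) →
  countFin f ≡ countFin (f ∘ (_↑ˡ L)) + countFin (f ∘ (K ↑ʳ_))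
count-↑ {zero} f = refl
count-↑ {suc K} {L} f = trans
  (cong (λ c → b2n (f zero) + c) (count-↑ {K} (f ∘ suc)))
  (sym (ℕ.+-assoc (b2n (f zero)) _ _))

-- Partitions and labellings

crosses⁺ : ∀ {n k} (p : Fin n → Fin k) {s : Subset n} {u v} →
  u ∈ s → v ∈ s → p u ≢ p v → crosses p s ≡ true
crosses⁺ p {u = u} {v} u∈s v∈s pu≢pv =
  anyFin⁺ _ u (anyFin⁺ _ v (cong₂ _∧_ ([]=⇒lookup u∈s)
    (cong₂ _∧_ ([]=⇒lookup v∈s) (cong not (isYes-false (p u ≟ p v) pu≢pv)))))

crosses⁻ : ∀ {n k} (p : Fin n → Fin k) {s : Subset n} → crosses p s ≡ true →
  ∃₂ λ u v → u ∈ s × v ∈ s × p u ≢ p v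
crosses⁻ p {s} crossing with anyFin⁻ _ crossing
... | u , any-v with anyFin⁻ _ any-v
...   | v , h = u , v , lookup⇒[]= u s su , lookup⇒[]= v s sv , pu≢pv
  where
  su = ∧-conicalˡ (lookup s u) _ h
  sv = ∧-conicalˡ (lookup s v) _ (∧-conicalʳ (lookup s u) _ h)
  pu≢pv : p u ≢ p v
  pu≢pv pu≡pv = contradiction
    (trans (sym (∧-conicalʳ (lookup s v) _ (∧-conicalʳ (lookup s u) _ h)))
           (cong not (isYes⁺ (p u ≟ p v) pu≡pv)))
    λ ()

crosses-∘ : ∀ {n k k'} (g : Fin k → Fin k') (p : Fin n → Fin k) {s : Subset n} →
  crosses (g ∘ p) s ≡ true → crosses p s ≡ true
crosses-∘ g p {s} crossing with crosses⁻ (g ∘ p) {s} crossing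
... | u , v , u∈s , v∈s , gpu≢gpv = crosses⁺ p {s} u∈s v∈s (gpu≢gpv ∘ cong g)

∈-part⁺ : ∀ {n k} {S : Subset n} {p : Fin n → Fin k} {i u} → u ∈ S → p u ≡ i → u ∈ part S p i
∈-part⁺ {p = p} {i} {u} u∈S pu≡i = ∈-tabulate⁺ (cong₂ _∧_ ([]=⇒lookup u∈S) (isYes⁺ (p u ≟ i) pu≡i))

∈-part⁻ : ∀ {n k} {S : Subset n} {p : Fin n → Fin k} {i u} → u ∈ part S p i → u ∈ S × p u ≡ i
∈-part⁻ {S = S} {p} {i} {u} u∈V =
  lookup⇒[]= u S (∧-conicalˡ _ _ h) , isYes⁻ (p u ≟ i) (∧-conicalʳ _ _ h)
  where h = ∈-tabulate⁻ u∈V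

crossing⊎⊆part : ∀ {n k} {S s : Subset n} (p : Fin n → Fin (suc k)) → s ⊆ S →
  (∃₂ λ u v → u ∈ s × v ∈ s × p u ≢ p v) ⊎ (∃ λ i → s ⊆ part S p i)
crossing⊎⊆part {s = s} p s⊆S with nonempty? s
... | no empty = inj₂ (zero , λ x∈s → contradiction (_ , x∈s) empty)
... | yes (w , w∈s) with any? (λ u → (u ∈? s) ×-dec ¬? (p u ≟ p w))
...   | yes (u , u∈s , pu≢pw) = inj₁ (u , w , u∈s , w∈s , pu≢pw)
...   | no ¬split = inj₂ (p w , λ {x} x∈s →
          ∈-part⁺ (s⊆S x∈s) (decidable-stable (p x ≟ p w) (λ px≢pw → ¬split (x , x∈s , px≢pw))))

usesLabel : ∀ {n k} → Subset n → (Fin n → Fin k) → Fin k → Bool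
usesLabel S q l = anyFin λ u → lookup S u ∧ ⌊ q u ≟ l ⌋

#labels : ∀ {n k} → Subset n → (Fin n → Fin k) → ℕ
#labels S q = countFin (usesLabel S q)

usesLabel⁺ : ∀ {n k} (S : Subset n) (q : Fin n → Fin k) {u l} → u ∈ S → q u ≡ l →
  usesLabel S q l ≡ true
usesLabel⁺ S q {u} {l} u∈S qu≡l =
  anyFin⁺ _ u (cong₂ _∧_ ([]=⇒lookup u∈S) (isYes⁺ (q u ≟ l) qu≡l))

usesLabel⁻ : ∀ {n k} (S : Subset n) (q : Fin n → Fin k) {l} → usesLabel S q l ≡ true →
  ∃ λ u → u ∈ S × q u ≡ l
usesLabel⁻ S q {l} used with anyFin⁻ _ used
... | u , h = u , lookup⇒[]= u S (∧-conicalˡ _ _ h) , isYes⁻ (q u ≟ l) (∧-conicalʳ (lookup S u) _ h)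

#labels-partition : ∀ {n j} {S : Subset n} {p : Fin n → Fin (2 + j)} → IsPartition S j p →
  #labels S p ≡ 2 + j
#labels-partition {S = S} {p} P = count-all λ i → let u , u∈S , pu≡i = P i in usesLabel⁺ S p u∈S pu≡i

all-used⊎unused : ∀ {n k} (S : Subset n) (q : Fin n → Fin k) →
  (∀ l → usesLabel S q l ≡ true) ⊎ (∃ λ l → usesLabel S q l ≡ false)
all-used⊎unused S q with all? (λ l → usesLabel S q l ≟ᵇ true)
... | yes used = inj₁ used
... | no ¬used =
  let l , unused = ¬∀⟶∃¬ _ _ (λ l → usesLabel S q l ≟ᵇ true) ¬used in inj₂ (l , ¬-not unused)

-- Deletes label l, shifting the labels above it down; l itself is sent to the arbitrary label zero.
dropLabel : ∀ {k} → Fin (suc (suc k)) → Fin (suc (suc k)) → Fin (suc k)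
dropLabel l x with l ≟ x
... | yes _ = zero
... | no l≢x = punchOut l≢x

dropLabel-punchIn : ∀ {k} (l : Fin (suc (suc k))) m → dropLabel l (punchIn l m) ≡ m
dropLabel-punchIn l m with l ≟ punchIn l m
... | yes l≡ = contradiction (sym l≡) (punchInᵢ≢i l m)
... | no _ = trans (punchOut-cong l refl) (punchOut-punchIn l)

#labels-dropLabel : ∀ {n k} {S : Subset n} (q : Fin n → Fin (suc (suc k))) {l} →
  usesLabel S q l ≡ false → #labels S q ≤ #labels S (dropLabel l ∘ q)
#labels-dropLabel {S = S} q {l} unused = begin
  #labels S q                            ≡⟨ count-punchIn (usesLabel S q) l ⟩
  b2n (usesLabel S q l) + countFin rest  ≡⟨ cong (λ b → b2n b + countFin rest) unused ⟩
  countFin rest                          ≤⟨ count-mono kept ⟩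
  #labels S (dropLabel l ∘ q)            ∎
  where
  open ℕ.≤-Reasoning
  rest = usesLabel S q ∘ punchIn l
  kept : ∀ m → rest m ≡ true → usesLabel S (dropLabel l ∘ q) m ≡ true
  kept m used with usesLabel⁻ S q used
  ... | u , u∈S , qu≡ =
    usesLabel⁺ S (dropLabel l ∘ q) u∈S (trans (cong (dropLabel l) qu≡) (dropLabel-punchIn l m))

refineLabel : ∀ {n k l} → (Fin n → Fin k) → Fin k → (Fin n → Fin l) → Fin n → Fin (k + l)
refineLabel {k = k} {l} p i Q u with p u ≟ i
... | yes _ = k ↑ʳ Q u
... | no _ = p u ↑ˡ l

refineLabel-inside : ∀ {n k l} (p : Fin n → Fin k) {i} (Q : Fin n → Fin l) {u} →
  p u ≡ i → refineLabel p i Q u ≡ k ↑ʳ Q u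
refineLabel-inside p {i} Q {u} pu≡i with p u ≟ i
... | yes _ = refl
... | no pu≢i = contradiction pu≡i pu≢i

refineLabel-outside : ∀ {n k l} (p : Fin n → Fin k) {i} (Q : Fin n → Fin l) {u} →
  p u ≢ i → refineLabel p i Q u ≡ p u ↑ˡ l
refineLabel-outside p {i} Q {u} pu≢i with p u ≟ i
... | yes pu≡i = contradiction pu≡i pu≢i
... | no _ = refl

refineLabel-split : ∀ {n k l} (p : Fin n → Fin k) {i} (Q : Fin n → Fin l) {u v} → p u ≡ p v →
  refineLabel p i Q u ≢ refineLabel p i Q v → p u ≡ i × Q u ≢ Q v
refineLabel-split {k = k} {l} p {i} Q {u} {v} pu≡pv ru≢rv = case p u ≟ i of λ where
    (yes pu≡i) → pu≡i , λ Qu≡Qv → ru≢rv (begin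
      refineLabel p i Q u ≡⟨ refineLabel-inside p Q pu≡i ⟩
      k ↑ʳ Q u            ≡⟨ cong (k ↑ʳ_) Qu≡Qv ⟩
      k ↑ʳ Q v            ≡⟨ refineLabel-inside p Q (trans (sym pu≡pv) pu≡i) ⟨
      refineLabel p i Q v ∎)
    (no pu≢i) → contradiction (begin
      refineLabel p i Q u ≡⟨ refineLabel-outside p Q pu≢i ⟩
      p u ↑ˡ l            ≡⟨ cong (_↑ˡ l) pu≡pv ⟩
      p v ↑ˡ l            ≡⟨ refineLabel-outside p Q (pu≢i ∘ trans pu≡pv) ⟨
      refineLabel p i Q v ∎) ru≢rv
  where open ≡-Reasoning

#labels-refine : ∀ {n j a} {S : Subset n} {p : Fin n → Fin (2 + j)} {i} {Q : Fin n → Fin (2 + a)} →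
  IsPartition S j p → IsPartition (part S p i) a Q →
  suc j + (2 + a) ≤ #labels S (refineLabel p i Q)
#labels-refine {j = j} {a} {S} {p} {i} {Q} P PQ = begin
  suc j + (2 + a)                            ≤⟨ ℕ.+-mono-≤ (count-punchIn-all {f = old-labels} i old)
                                                             (ℕ.≤-reflexive (sym (count-all new))) ⟩
  countFin old-labels + countFin new-labels  ≡⟨ count-↑ {2 + j} {2 + a} used ⟨
  #labels S (refineLabel p i Q)              ∎
  where
  open ℕ.≤-Reasoning
  used = usesLabel S (refineLabel p i Q)
  old-labels : Fin (2 + j) → Bool
  old-labels l = used (l ↑ˡ (2 + a))
  new-labels : Fin (2 + a) → Bool
  new-labels l = used ((2 + j) ↑ʳ l)
  old : ∀ m → old-labels (punchIn i m) ≡ true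
  old m = let u , u∈S , pu≡ = P (punchIn i m) in usesLabel⁺ S (refineLabel p i Q) u∈S
    (trans (refineLabel-outside p Q (λ pu≡i → punchInᵢ≢i i m (trans (sym pu≡) pu≡i)))
           (cong (_↑ˡ (2 + a)) pu≡))
  new : ∀ m → new-labels m ≡ true
  new m = let u , u∈V , Qu≡m = PQ m ; u∈S , pu≡i = ∈-part⁻ u∈V in
    usesLabel⁺ S (refineLabel p i Q) u∈S
      (trans (refineLabel-inside p Q pu≡i) (cong ((2 + j) ↑ʳ_) Qu≡m))

mergeLabels : ∀ {k} → (Fin k → Bool) → Fin k → Fin k → Fin k
mergeLabels b l₀ l = if b l then l₀ else l

mergeLabels-true : ∀ {k} (b : Fin k → Bool) {l₀ l} → b l ≡ true → mergeLabels b l₀ l ≡ l₀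
mergeLabels-true b bl rewrite bl = refl

mergeLabels-false : ∀ {k} (b : Fin k → Bool) {l₀ l} → b l ≡ false → mergeLabels b l₀ l ≡ l
mergeLabels-false b bl rewrite bl = refl

#labels-merge : ∀ {n k} {S T : Subset n} (p : Fin n → Fin (suc k)) {u} → T ⊆ S → u ∈ T →
  suc (#labels S p) ≤ #labels S (mergeLabels (usesLabel T p) (p u) ∘ p) + #labels T p
#labels-merge {S = S} {T} p {u} T⊆S u∈T = begin
  suc (#labels S p)                          ≡⟨ cong suc (count-punchIn (usesLabel S p) (p u)) ⟩
  suc (b2n (usesLabel S p (p u)) + countFin (usesLabel S p ∘ punchIn (p u)))
                                             ≤⟨ s≤s (ℕ.+-monoˡ-≤ _ (b2n≤1 (usesLabel S p (p u)))) ⟩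
  suc (suc (countFin (usesLabel S p ∘ punchIn (p u))))
                                             ≤⟨ s≤s (s≤s (count-∨ (λ m → old-or-in-T (punchIn (p u) m)))) ⟩
  suc (suc (countFin (usesLabel S q ∘ punchIn (p u)) + countFin (usesLabel T p ∘ punchIn (p u))))
                                             ≡⟨ cong suc (ℕ.+-suc _ _) ⟨
  suc (countFin (usesLabel S q ∘ punchIn (p u))) + suc (countFin (usesLabel T p ∘ punchIn (p u)))
                                             ≡⟨ cong₂ _+_ (count-punchIn-true {f = usesLabel S q} q-uses-pu)
                                                          (count-punchIn-true {f = usesLabel T p} p-uses-pu) ⟨
  #labels S q + #labels T p                  ∎
  where
  open ℕ.≤-Reasoning
  q = mergeLabels (usesLabel T p) (p u) ∘ p
  p-uses-pu : usesLabel T p (p u) ≡ true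
  p-uses-pu = usesLabel⁺ T p u∈T refl
  q-uses-pu : usesLabel S q (p u) ≡ true
  q-uses-pu = usesLabel⁺ S q (T⊆S u∈T) (mergeLabels-true (usesLabel T p) p-uses-pu)
  old-or-in-T : ∀ l → usesLabel S p l ≡ true → usesLabel S q l ≡ true ⊎ usesLabel T p l ≡ true
  old-or-in-T l used with usesLabel T p l in in-T
  ... | true = inj₂ refl
  ... | false = let w , w∈S , pw≡l = usesLabel⁻ S p used in inj₁ (usesLabel⁺ S q w∈S
    (trans (mergeLabels-false (usesLabel T p) (trans (cong (usesLabel T p) pw≡l) in-T)) pw≡l))

-- Ratios

toℚᵘ-/ : ∀ c d → toℚᵘ ((+ c) / suc d) ≃ᵘ mkℚᵘ (+ c) d
toℚᵘ-/ c d = ℚ.toℚᵘ-fromℚᵘ (mkℚᵘ (+ c) d)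

*≤*⇒/≤/ : ∀ a b c d → a * suc d ≤ c * suc b → (+ a) / suc b ≤ℚ (+ c) / suc d
*≤*⇒/≤/ a b c d ad≤cb = ℚ.toℚᵘ-cancel-≤
  (ℚᵘ.≤-respˡ-≃ (ℚᵘ.≃-sym (toℚᵘ-/ a b)) (ℚᵘ.≤-respʳ-≃ (ℚᵘ.≃-sym (toℚᵘ-/ c d))
    (*≤* (subst₂ _≤ℤ_ (ℤ.pos-* a (suc d)) (ℤ.pos-* c (suc b)) (+≤+ ad≤cb)))))

/≤/⇒*≤* : ∀ a b c d → (+ a) / suc b ≤ℚ (+ c) / suc d → a * suc d ≤ c * suc b
/≤/⇒*≤* a b c d a/b≤c/d
  with ℚᵘ.≤-respˡ-≃ (toℚᵘ-/ a b) (ℚᵘ.≤-respʳ-≃ (toℚᵘ-/ c d) (ℚ.toℚᵘ-mono-≤ a/b≤c/d))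
... | *≤* ad≤cb = ℤ.drop‿+≤+ (subst₂ _≤ℤ_ (sym (ℤ.pos-* a (suc d))) (sym (ℤ.pos-* c (suc b))) ad≤cb)

/-monoˡ-≤ : ∀ {a c} b → a ≤ c → (+ a) / suc b ≤ℚ (+ c) / suc b
/-monoˡ-≤ {a} {c} b a≤c = *≤*⇒/≤/ a b c b (ℕ.*-monoˡ-≤ (suc b) a≤c)

/-antimonoʳ-≤ : ∀ a {b d} → b ≤ d → (+ a) / suc d ≤ℚ (+ a) / suc b
/-antimonoʳ-≤ a {b} {d} b≤d = *≤*⇒/≤/ a d a b (ℕ.*-monoʳ-≤ a (s≤s b≤d))

≤-mediant⇒≤ : ∀ c x j a → c * (suc j + suc a) ≤ (c + x) * suc j → c * suc a ≤ x * suc j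
≤-mediant⇒≤ c x j a h = ℕ.+-cancelˡ-≤ (c * suc j) _ _ (begin
  c * suc j + c * suc a   ≡⟨ ℕ.*-distribˡ-+ c (suc j) (suc a) ⟨
  c * (suc j + suc a)     ≤⟨ h ⟩
  (c + x) * suc j         ≡⟨ ℕ.*-distribʳ-+ (suc j) c x ⟩
  c * suc j + x * suc j   ∎)
  where open ℕ.≤-Reasoning

-- With c' + x ≤ c and (1 + t) + (1 + s) = 1 + j, c / (1 + j) ≤ c' / (1 + t) implies
-- x / (1 + s) ≤ c / (1 + j); if j ≤ s, already x ≤ c suffices.
mediant-≤⇒≥ : ∀ {c c' x s j k} → c' + x ≤ c → 3 + j ≤ k + (2 + s) →
  (∀ {t} → 2 + t ≤ k → c * suc t ≤ c' * suc j) → x * suc j ≤ c * suc s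
mediant-≤⇒≥ {c} {c'} {x} {s} {j} {k} c'+x≤c j≤k+s bound with j ℕ.≤? s
... | yes j≤s = ℕ.*-mono-≤ (ℕ.≤-trans (ℕ.m≤n+m x c') c'+x≤c) (s≤s j≤s)
... | no j≰s with ℕ.m≤n⇒∃[o]m+o≡n (ℕ.≰⇒> j≰s)
...   | t , refl = ℕ.+-cancelˡ-≤ (c * suc t) _ _ (begin
  c * suc t + x * suc j       ≤⟨ ℕ.+-monoˡ-≤ _ (bound 2+t≤k) ⟩
  c' * suc j + x * suc j      ≡⟨ ℕ.*-distribʳ-+ (suc j) c' x ⟨
  (c' + x) * suc j            ≤⟨ ℕ.*-monoˡ-≤ (suc j) c'+x≤c ⟩
  c * suc j                   ≡⟨ cong (λ z → c * suc z) (ℕ.+-comm (suc s) t) ⟩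
  c * (suc t + suc s)         ≡⟨ ℕ.*-distribˡ-+ c (suc t) (suc s) ⟩
  c * suc t + c * suc s       ∎)
  where
  open ℕ.≤-Reasoning
  reorder : ∀ s t → 2 + t + (2 + s) ≡ 3 + (suc s + t)
  reorder = solve-∀
  2+t≤k : 2 + t ≤ k
  2+t≤k = ℕ.+-cancelʳ-≤ (2 + s) (2 + t) k
    (ℕ.≤-trans (ℕ.≤-reflexive (reorder s t)) j≤k+s)

∈-atLeast⁺ : ∀ {m} {μ : ℚ} {σ : Fin m → ℚ} {e} → μ ≤ℚ σ e → e ∈ atLeast μ σ
∈-atLeast⁺ {μ = μ} {σ} {e} μ≤σe = ∈-tabulate⁺
  (cong not (isYes-false (σ e <? μ) λ σe<μ → ℚ.<-irrefl refl (ℚ.<-≤-trans σe<μ μ≤σe)))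

∈-atLeast⁻ : ∀ {m} {μ : ℚ} {σ : Fin m → ℚ} {e} → e ∈ atLeast μ σ → μ ≤ℚ σ e
∈-atLeast⁻ {μ = μ} {σ} {e} e∈ = ℚ.≮⇒≥ λ σe<μ →
  contradiction (trans (sym (∈-tabulate⁻ e∈)) (cong not (isYes⁺ (σ e <? μ) σe<μ))) λ ()

-- Strength

module _ {n m : ℕ} (E : Fin m → Subset n) where

  -- Φ of the hypergraph (S, B) is at least μ. Optimal E S A j p unfolds to ΦAtLeast S A (ratio E A j p).
  ΦAtLeast : Subset n → Subset m → ℚ → Set
  ΦAtLeast S B μ = ∀ j (p : Fin n → Fin (2 + j)) → IsPartition S j p → μ ≤ℚ ratio E B j p

  EdgesWithin : Subset n → Subset m → Set
  EdgesWithin S A = ∀ {e} → e ∈ A → E e ⊆ S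

  Crossing : ∀ {k} → Subset m → (Fin n → Fin k) → Fin m → Set
  Crossing A p e = e ∈ A × crosses p (E e) ≡ true

  ∈-inside⁺ : ∀ {A T e} → e ∈ A → E e ⊆ T → e ∈ inside E A T
  ∈-inside⁺ {A} {T} {e} e∈A e⊆T = ∈-tabulate⁺ (cong₂ _∧_ ([]=⇒lookup e∈A) (isYes⁺ (E e ⊆? T) e⊆T))

  ∈-inside⁻ : ∀ {A T e} → e ∈ inside E A T → e ∈ A × E e ⊆ T
  ∈-inside⁻ {A} {T} {e} e∈ =
    lookup⇒[]= e A (∧-conicalˡ _ _ h) , isYes⁻ (E e ⊆? T) (∧-conicalʳ (lookup A e) _ h)
    where h = ∈-tabulate⁻ e∈

  inside-within : ∀ A T → EdgesWithin T (inside E A T)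
  inside-within A T = proj₂ ∘ ∈-inside⁻ {A} {T}

  inside-⊆-inside : ∀ {A T V} → T ⊆ V → inside E A T ⊆ inside E (inside E A V) T
  inside-⊆-inside {A} {T} T⊆V e∈ = let e∈A , e⊆T = ∈-inside⁻ {A} {T} e∈ in
    ∈-inside⁺ (∈-inside⁺ e∈A (T⊆V ∘ e⊆T)) e⊆T

  crossingᵇ : ∀ {k} → Subset m → (Fin n → Fin k) → Fin m → Bool
  crossingᵇ A p e = lookup A e ∧ crosses p (E e)

  crossingᵇ⁻ : ∀ {k} {A} {p : Fin n → Fin k} {e} → crossingᵇ A p e ≡ true → Crossing A p e
  crossingᵇ⁻ {A = A} {e = e} h = lookup⇒[]= e A (∧-conicalˡ _ _ h) , ∧-conicalʳ (lookup A e) _ h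

  crossingᵇ⁺ : ∀ {k} {A} {p : Fin n → Fin k} {e} → Crossing A p e → crossingᵇ A p e ≡ true
  crossingᵇ⁺ (e∈A , c) = cong₂ _∧_ ([]=⇒lookup e∈A) c

  crossCount-mono : ∀ {k k'} {A A'} {p : Fin n → Fin k} {p' : Fin n → Fin k'} →
    (∀ {e} → Crossing A p e → Crossing A' p' e) → crossCount E A p ≤ crossCount E A' p'
  crossCount-mono {A = A} {A'} {p} {p'} c⇒c' =
    count-mono {f = crossingᵇ A p} {crossingᵇ A' p'} λ _ → crossingᵇ⁺ ∘ c⇒c' ∘ crossingᵇ⁻

  crossCount-∨ : ∀ {k k' k''} {A A' A''} {p : Fin n → Fin k} {p' : Fin n → Fin k'} {p'' : Fin n → Fin k''} →
    (∀ {e} → Crossing A p e → Crossing A' p' e ⊎ Crossing A'' p'' e) →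
    crossCount E A p ≤ crossCount E A' p' + crossCount E A'' p''
  crossCount-∨ {A = A} {A'} {A''} {p} {p'} {p''} split =
    count-∨ {f = crossingᵇ A' p'} {crossingᵇ A'' p''} {crossingᵇ A p}
      λ _ h → Sum.map crossingᵇ⁺ crossingᵇ⁺ (split (crossingᵇ⁻ h))

  crossCount-disjoint : ∀ {k k' k''} {A A' A''} {p : Fin n → Fin k} {p' : Fin n → Fin k'} {p'' : Fin n → Fin k''} →
    (∀ {e} → Crossing A p e → Crossing A'' p'' e) → (∀ {e} → Crossing A' p' e → Crossing A'' p'' e) →
    (∀ {e} → Crossing A p e → Crossing A' p' e → ⊥) →
    crossCount E A p + crossCount E A' p' ≤ crossCount E A'' p''
  crossCount-disjoint {A = A} {A'} {A''} {p} {p'} {p''} c⇒c'' c'⇒c'' disjoint =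
    count-disjoint {f = crossingᵇ A p} {crossingᵇ A' p'} {crossingᵇ A'' p''}
      (λ _ → crossingᵇ⁺ ∘ c⇒c'' ∘ crossingᵇ⁻) (λ _ → crossingᵇ⁺ ∘ c'⇒c'' ∘ crossingᵇ⁻)
      (λ _ h h' → disjoint (crossingᵇ⁻ h) (crossingᵇ⁻ h'))

  ΦAtLeast-≤ : ∀ {S B μ μ'} → μ' ≤ℚ μ → ΦAtLeast S B μ → ΦAtLeast S B μ'
  ΦAtLeast-≤ μ'≤μ Φ≥ j p P = ℚ.≤-trans μ'≤μ (Φ≥ j p P)

  ΦAtLeast-⊆ : ∀ {S B B' μ} → B ⊆ B' → ΦAtLeast S B μ → ΦAtLeast S B' μ
  ΦAtLeast-⊆ {B = B} {B'} B⊆B' Φ≥ j p P = ℚ.≤-trans (Φ≥ j p P)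
    (/-monoˡ-≤ j (crossCount-mono {A = B} {B'} {p} {p} λ (e∈B , c) → B⊆B' e∈B , c))

  ΦAtLeast-inside : ∀ {A T V μ} → T ⊆ V → ΦAtLeast T (inside E A T) μ →
    ΦAtLeast T (inside E (inside E A V) T) μ
  ΦAtLeast-inside {A} {T} T⊆V = ΦAtLeast-⊆ {B = inside E A T} (inside-⊆-inside {A} {T} T⊆V)

  crossCount-∘ : ∀ {k k'} {B} (g : Fin k → Fin k') (q : Fin n → Fin k) →
    crossCount E B (g ∘ q) ≤ crossCount E B q
  crossCount-∘ {B = B} g q = crossCount-mono {A = B} {B} {g ∘ q} {q}
    λ {e} (e∈B , c) → e∈B , crosses-∘ g q {E e} c

  ΦAtLeast⇒surjective-labelling : ∀ {S B μ j t} → ΦAtLeast S B μ → (q : Fin n → Fin (2 + j)) →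
    (∀ l → usesLabel S q l ≡ true) → t ≤ j → μ ≤ℚ (+ crossCount E B q) / suc t
  ΦAtLeast⇒surjective-labelling {S} {B} {j = j} Φ≥ q used t≤j =
    ℚ.≤-trans (Φ≥ j q λ l → usesLabel⁻ S q (used l)) (/-antimonoʳ-≤ (crossCount E B q) t≤j)

  -- Labels unused on S are dropped one at a time; the case split uses plain lambdas, which (unlike
  -- where- or with-functions) let the termination checker see k decrease.
  ΦAtLeast⇒labelling : ∀ {S B μ} → ΦAtLeast S B μ → ∀ {k} (q : Fin n → Fin k) {t} →
    2 + t ≤ #labels S q → μ ≤ℚ (+ crossCount E B q) / suc t
  ΦAtLeast⇒labelling Φ≥ {zero} q ()
  ΦAtLeast⇒labelling {S} Φ≥ {suc zero} q 2+t≤ with ℕ.≤-trans 2+t≤ (count≤n (usesLabel S q))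
  ... | s≤s ()
  ΦAtLeast⇒labelling {S} {B} {μ} Φ≥ {suc (suc k)} q 2+t≤ = Sum.[
    (λ used → ΦAtLeast⇒surjective-labelling {S} {B} {μ} Φ≥ q used
      (s≤s⁻¹ (s≤s⁻¹ (ℕ.≤-trans 2+t≤ (ℕ.≤-reflexive (count-all used)))))) ,
    (λ (l , unused) → ℚ.≤-trans
      (ΦAtLeast⇒labelling {S} {B} {μ} Φ≥ (dropLabel l ∘ q)
        (ℕ.≤-trans 2+t≤ (#labels-dropLabel {S = S} q unused)))
      (/-monoˡ-≤ _ (crossCount-∘ {B = B} (dropLabel l) q))) ]
    (all-used⊎unused S q)

  crossing-refine : ∀ {S A j a} {p : Fin n → Fin (2 + j)} {i} {Q : Fin n → Fin (2 + a)} →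
    EdgesWithin S A → ∀ {e} → Crossing A (refineLabel p i Q) e →
    Crossing A p e ⊎ Crossing (inside E A (part S p i)) Q e
  crossing-refine {S} {A} {p = p} {i} {Q} W {e} (e∈A , c) with crosses⁻ (refineLabel p i Q) {E e} c
  ... | u , v , u∈e , v∈e , ru≢rv with crossing⊎⊆part p (W e∈A)
  ...   | inj₁ (u' , v' , u'∈e , v'∈e , pu'≢pv') = inj₁ (e∈A , crosses⁺ p u'∈e v'∈e pu'≢pv')
  ...   | inj₂ (i' , e⊆V') =
    let pu≡i' = proj₂ (∈-part⁻ {S = S} {p} (e⊆V' u∈e))
        pv≡i' = proj₂ (∈-part⁻ {S = S} {p} (e⊆V' v∈e))
        pu≡i , Qu≢Qv = refineLabel-split p Q (trans pu≡i' (sym pv≡i')) ru≢rv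
        e⊆V = subst (λ i → E e ⊆ part S p i) (trans (sym pu≡i') pu≡i) e⊆V'
    in inj₂ (∈-inside⁺ e∈A e⊆V , crosses⁺ Q u∈e v∈e Qu≢Qv)

  -- Refine part i of p by Q and compare with p.
  ΦAtLeast-part : ∀ {S A j} {p : Fin n → Fin (2 + j)} → EdgesWithin S A → IsPartition S j p →
    Optimal E S A j p → ∀ i → ΦAtLeast (part S p i) (inside E A (part S p i)) (ratio E A j p)
  ΦAtLeast-part {S} {A} {j} {p} W P opt i a Q PQ = *≤*⇒/≤/ c j x a (≤-mediant⇒≤ c x j a (begin
    c * (suc j + suc a)  ≤⟨ /≤/⇒*≤* c j y (j + suc a) (ΦAtLeast⇒labelling {S} {A} opt r 2+t≤) ⟩
    y * suc j            ≤⟨ ℕ.*-monoˡ-≤ (suc j) (crossCount-∨ (crossing-refine {S} {A} {p = p} {i} {Q} W)) ⟩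
    (c + x) * suc j      ∎))
    where
    open ℕ.≤-Reasoning
    r = refineLabel p i Q
    c = crossCount E A p
    x = crossCount E (inside E A (part S p i)) Q
    y = crossCount E A r
    2+t≤ : 2 + (j + suc a) ≤ #labels S r
    2+t≤ = subst (_≤ #labels S r) (cong suc (ℕ.+-suc j (suc a))) (#labels-refine P PQ)

  -- Merge every part of p that meets T into the part of u (labelling q) and compare with p.
  crossing-set-Φ≤optimal : ∀ {S T A j μ} {p : Fin n → Fin (2 + j)} {u v} → T ⊆ S → IsPartition S j p →
    Optimal E S A j p → u ∈ T → v ∈ T → p u ≢ p v → ΦAtLeast T (inside E A T) μ → μ ≤ℚ ratio E A j p
  crossing-set-Φ≤optimal {S} {T} {A} {j} {μ} {p} {u} {v} T⊆S P opt u∈T v∈T pu≢pv Φ≥ =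
    ℚ.≤-trans (ΦAtLeast⇒labelling {T} {inside E A T} Φ≥ p (ℕ.≤-reflexive 2+s≡))
      (*≤*⇒/≤/ x s c j (mediant-≤⇒≥ {c} {c'} {x} c'+x≤c labels-bound bound))
    where
    s,2+s≡ : ∃ λ s → 2 + s ≡ #labels T p
    s,2+s≡ = ℕ.m≤n⇒∃[o]m+o≡n
      (count≥2 {f = usesLabel T p} (usesLabel⁺ T p u∈T refl) (usesLabel⁺ T p v∈T refl) pu≢pv)
    s = proj₁ s,2+s≡
    2+s≡ = proj₂ s,2+s≡
    q = mergeLabels (usesLabel T p) (p u) ∘ p
    c = crossCount E A p
    c' = crossCount E A q
    x = crossCount E (inside E A T) p
    labels-bound : 3 + j ≤ #labels S q + (2 + s)
    labels-bound = subst₂ _≤_ (cong suc (#labels-partition P)) (cong (λ z → #labels S q + z) (sym 2+s≡))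
      (#labels-merge p T⊆S u∈T)
    bound : ∀ {t} → 2 + t ≤ #labels S q → c * suc t ≤ c' * suc j
    bound {t} h = /≤/⇒*≤* c j c' t (ΦAtLeast⇒labelling {S} {A} opt q h)
    merged : ∀ {w} → w ∈ T → q w ≡ p u
    merged w∈T = mergeLabels-true (usesLabel T p) (usesLabel⁺ T p w∈T refl)
    not-both : ∀ {e} → Crossing A q e → Crossing (inside E A T) p e → ⊥
    not-both {e} (_ , crosses-q) (e∈ , _) with crosses⁻ q {E e} crosses-q
    ... | u' , v' , u'∈e , v'∈e , qu'≢qv' =
      let e⊆T = proj₂ (∈-inside⁻ {A} {T} e∈) in
      qu'≢qv' (trans (merged (e⊆T u'∈e)) (sym (merged (e⊆T v'∈e))))
    c'+x≤c : c' + x ≤ c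
    c'+x≤c = crossCount-disjoint {A = A} {inside E A T} {A} {q} {p} {p}
      (λ {e} (e∈A , cq) → e∈A , crosses-∘ (mergeLabels (usesLabel T p) (p u)) p {E e} cq)
      (λ (e∈ , cp) → proj₁ (∈-inside⁻ {A} {T} e∈) , cp) not-both

  Φ≤strength : ∀ {S A σ T μ e} → IsStrength E S A σ → EdgesWithin S A → T ⊆ S →
    ΦAtLeast T (inside E A T) μ → e ∈ A → E e ⊆ T → μ ≤ℚ σ e
  Φ≤strength (leaf no-edges) _ _ _ e∈A _ = ⊥-elim (no-edges _ e∈A)
  Φ≤strength {S} {A} {σ} {T} {μ} {e} (node j p P opt ratio-on-crossing parts) W T⊆S Φ≥ e∈A e⊆T =
    case crossing⊎⊆part p T⊆S of λ where
      (inj₂ (i , T⊆V)) →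
        Φ≤strength (parts i) (inside-within A (part S p i)) T⊆V (ΦAtLeast-inside {A} T⊆V Φ≥)
          (∈-inside⁺ {A} {part S p i} e∈A (T⊆V ∘ e⊆T)) e⊆T
      (inj₁ (u , v , u∈T , v∈T , pu≢pv)) →
        let μ≤ratio = crossing-set-Φ≤optimal {S} {T} {A} T⊆S P opt u∈T v∈T pu≢pv Φ≥ in
        case crossing⊎⊆part p (W e∈A) of λ where
          (inj₁ (u' , v' , u'∈e , v'∈e , pu'≢pv')) →
            subst (μ ≤ℚ_) (sym (ratio-on-crossing e e∈A (crosses⁺ p u'∈e v'∈e pu'≢pv'))) μ≤ratio
          (inj₂ (i , e⊆V)) →
            Φ≤strength (parts i) (inside-within A (part S p i)) ⊆-refl
              (ΦAtLeast-inside {A} ⊆-refl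
                (ΦAtLeast-≤ {B = inside E A (part S p i)} μ≤ratio (ΦAtLeast-part {S} {A} W P opt i)))
              (∈-inside⁺ {A} {part S p i} e∈A e⊆V) e⊆V

  strong-superset : ∀ {S A σ μ e} → IsStrength E S A σ → EdgesWithin S A → e ∈ A → μ ≤ℚ σ e →
    ∃ λ S' → E e ⊆ S' × ΦAtLeast S' (inside E (atLeast μ σ) S') μ
  strong-superset (leaf no-edges) _ e∈A _ = ⊥-elim (no-edges _ e∈A)
  strong-superset {S} {A} {σ} {μ} {e} H@(node j p P opt ratio-on-crossing parts) W e∈A μ≤σe =
    case crossing⊎⊆part p (W e∈A) of λ where
      (inj₂ (i , e⊆V)) →
        strong-superset (parts i) (inside-within A (part S p i)) (∈-inside⁺ {A} {part S p i} e∈A e⊆V) μ≤σe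
      (inj₁ (u , v , u∈e , v∈e , pu≢pv)) →
        let μ≤ratio : μ ≤ℚ ratio E A j p
            μ≤ratio = subst (μ ≤ℚ_) (ratio-on-crossing e e∈A (crosses⁺ p u∈e v∈e pu≢pv)) μ≤σe
            A⊆inside : A ⊆ inside E A S
            A⊆inside f∈A = ∈-inside⁺ f∈A (W f∈A)
            strong : A ⊆ inside E (atLeast μ σ) S
            strong f∈A = ∈-inside⁺ (∈-atLeast⁺ (ℚ.≤-trans μ≤ratio
              (Φ≤strength H W ⊆-refl (ΦAtLeast-⊆ {B = A} A⊆inside opt) f∈A (W f∈A)))) (W f∈A)
        in S , W e∈A , ΦAtLeast-⊆ {B = A} strong (ΦAtLeast-≤ {B = A} μ≤ratio opt)

-- Hyperedges with fewer than two vertices never cross a partition.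
mainTheorem9 : ∀ {n m : ℕ} (E : Fin m → Subset n) →
    (∀ e → 2 ≤ ∣ E e ∣) →
    (λ₀ : ℚ) (σ σ' : Fin m → ℚ) →
    IsStrength E ⊤ ⊤ σ →
    IsStrength E ⊤ (atLeast λ₀ σ) σ' →
    ∀ e → e ∈ atLeast λ₀ σ → λ₀ ≤ℚ σ' e
mainTheorem9 E _ λ₀ σ σ' strength strength' e e∈F =
  let S' , e⊆S' , Φ≥ = strong-superset E strength (λ _ _ → ∈⊤) ∈⊤ (∈-atLeast⁻ e∈F)
  in Φ≤strength E strength' (λ _ _ → ∈⊤) (λ _ → ∈⊤) Φ≥ e∈F e⊆S'
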